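{- Let $n \ge 3$ and let $\tau'(n)$ denote the smallest number $k$ such that there is a proper edge coloring $f\colon E(K_n)\to\{1,\dots,k\}$ of the complete graph $K_n$ that distinguishes triangles. Then $\tau'(n)=n$ if $n$ is odd, and $\tau'(n)=n+1$ if $n$ is even.
   Context: For an edge coloring $f\colon E\to\{1,\dots,k\}$ of a graph $G=(V,E)$ and a triangle $T\subseteq G$ (a subgraph isomorphic to $K_3$), the palette of $T$ is $F(T)=\{f(e): e\in E(T)\}$ (for a proper coloring this is a set of three distinct colors). The coloring $f$ distinguishes triangles if $F(T_1)\neq F(T_2)$ for every two different triangles $T_1,T_2$ of $G$. An edge coloring is proper if adjacent edges receive distinct colors. -}

module Defs where

open import Data.Nat using (ℕ; suc; _≤_; _+_)
open import Data.Fin using (Fin; _<_)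
open import Data.Product using (Σ; _×_; _,_; ∃)
open import Data.Sum using (_⊎_)
open import Relation.Binary.PropositionalEquality using (_≡_; _≢_)
open import Relation.Nullary using (¬_)

-- Vertices of K_n are Fin n; colours {1,…,k} are represented by Fin k.
-- An edge colouring of K_n is a symmetric function on pairs of vertices;
-- its values on the diagonal (i , i) are irrelevant (not edges).
record EdgeColouring (n k : ℕ) : Set where
  field
    col  : Fin n → Fin n → Fin k
    symm : ∀ i j → col i j ≡ col j i
open EdgeColouring public

Proper : ∀ {n k} → EdgeColouring n k → Set
Proper {n} f = ∀ (v a b : Fin n) → a ≢ v → b ≢ v → a ≢ b → col f v a ≢ col f v b

-- A triangle of K_n is a 3-element vertex set, represented uniquely by its
-- vertices listed in increasing order.
record Triangle (n : ℕ) : Set where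
  constructor tri
  field
    x y z : Fin n
    x<y : x < y
    y<z : y < z
open Triangle public

_∈Palette_ : ∀ {n k} → Fin k → (EdgeColouring n k × Triangle n) → Set
c ∈Palette (f , T) = (c ≡ col f (x T) (y T)) ⊎ (c ≡ col f (y T) (z T)) ⊎ (c ≡ col f (x T) (z T))

SamePalette : ∀ {n k} → EdgeColouring n k → Triangle n → Triangle n → Set
SamePalette {k = k} f T₁ T₂ =
  ∀ (c : Fin k) → (c ∈Palette (f , T₁) → c ∈Palette (f , T₂)) × (c ∈Palette (f , T₂) → c ∈Palette (f , T₁))

DifferentTriangles : ∀ {n} → Triangle n → Triangle n → Set
DifferentTriangles T₁ T₂ = ¬ ((x T₁ ≡ x T₂) × (y T₁ ≡ y T₂) × (z T₁ ≡ z T₂))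

DistinguishesTriangles : ∀ {n k} → EdgeColouring n k → Set
DistinguishesTriangles {n} f =
  ∀ (T₁ T₂ : Triangle n) → DifferentTriangles T₁ T₂ → ¬ SamePalette f T₁ T₂

TDColourable : ℕ → ℕ → Set
TDColourable n k = Σ (EdgeColouring n k) λ f → Proper f × DistinguishesTriangles f

IsTauPrime : ℕ → ℕ → Set
IsTauPrime n t = TDColourable n t × (∀ k → TDColourable n k → t ≤ k)

{-# OPTIONS --safe #-}

-- Upper bound: for odd m ≥ n colour the edge ij of K_n by i + j mod m. This is proper, and the
-- palette of a triangle {a, b, c} has sum 2(a + b + c); as 2 is invertible mod m, the palette
-- determines s = a + b + c, and then each vertex is s minus the colour of the opposite edge.
--
-- Lower bound: each vertex has n − 1 differently coloured edges. If two colours α ≠ β are seen at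
-- every vertex v, the triangle formed by v and its α- and β-neighbours has palette {α, β, d v}
-- with d v ∉ {α, β}, and v is recovered from the triangle; so distinguishing forces d to be
-- injective and k ≥ n + 2. With k = n − 1 every colour is seen everywhere, hence k ≥ n. With
-- k = n and n even, every vertex misses exactly one colour, at most one colour is seen everywhere,
-- and a missed colour is missed by an even number of vertices (its class is a matching), so at
-- least twice; this gives 2(n − 1) ≤ n, impossible for n ≥ 3.

module Submission where

open import Defs
open import Data.Nat using (ℕ; _≤_; _+_)
open import Data.Nat.Divisibility using (_∣_)
open import Data.Product using (_×_)
open import Relation.Nullary using (¬_)

open import Algebra.Definitions using (Involutive)
open import Data.Fin.Base as Fin using (Fin; zero; suc; toℕ; punchIn; punchOut; splitAt; join)
import Data.Fin.Properties as Fin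
open import Data.Nat.Base using (zero; suc; _*_; _%_; _<_; s≤s)
open import Data.Nat.DivMod
  using (_mod_; %-distribˡ-+; %-distribˡ-*; m%n%n≡m%n; [m+n]%n≡m%n; [m+kn]%n≡m%n; m<n⇒m%n≡m)
open import Data.Nat.Divisibility using (divides; n∣m*n)
import Data.Nat.Properties as ℕ
open import Algebra.Properties.CommutativeSemigroup ℕ.+-commutativeSemigroup
  using (xy∙z≈yx∙z; xy∙z≈xz∙y; xy∙z≈zx∙y; xy∙z≈yz∙x; xy∙z≈zy∙x)
open import Data.Nat.Tactic.RingSolver using (solve-∀)
open import Data.Product using (Σ-syntax; ∃-syntax; _,_; proj₁; proj₂)
open import Data.Sum using (_⊎_; inj₁; inj₂; [_,_])
open import Function.Base using (_∘_; id)
open import Function.Definitions using (Injective)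
open import Relation.Binary.Definitions using (tri<; tri≈; tri>)
open import Relation.Binary.PropositionalEquality
  using (_≡_; _≢_; refl; sym; trans; cong; cong₂; subst; subst₂; ≢-sym; module ≡-Reasoning)
open import Relation.Nullary using (Dec; yes; no; contradiction)
open import Level using (0ℓ)
open import Relation.Binary.Bundles using (Setoid)
import Relation.Binary.Reasoning.Setoid as ≈-Reasoning
open import Relation.Nullary.Decidable using (¬?; _×-dec_; decidable-stable)

private variable
  A : Set
  a b c u v w w₁ w₂ : A
  t t′ t″ : A × A × A
  n k : ℕ

infix 4 _∈₃_ _⊆₃_ _≋₃_ _↭₃_

_∈₃_ : A → A × A × A → Set
u ∈₃ (a , b , c) = u ≡ a ⊎ u ≡ b ⊎ u ≡ c

pattern first  = inj₁ refl
pattern second = inj₂ (inj₁ refl)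
pattern third  = inj₂ (inj₂ refl)

_⊆₃_ : A × A × A → A × A × A → Set
t ⊆₃ t′ = ∀ u → u ∈₃ t → u ∈₃ t′

_≋₃_ : A × A × A → A × A × A → Set
t ≋₃ t′ = ∀ u → (u ∈₃ t → u ∈₃ t′) × (u ∈₃ t′ → u ∈₃ t)

≋₃⇒⊆₃ : t ≋₃ t′ → t ⊆₃ t′
≋₃⇒⊆₃ eq u = proj₁ (eq u)

≋₃⇒⊇₃ : t ≋₃ t′ → t′ ⊆₃ t
≋₃⇒⊇₃ eq u = proj₂ (eq u)

≋₃-refl : t ≋₃ t
≋₃-refl u = id , id

⊆₃-trans : t ⊆₃ t′ → t′ ⊆₃ t″ → t ⊆₃ t″
⊆₃-trans t⊆t′ t′⊆t″ u = t′⊆t″ u ∘ t⊆t′ u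

≋₃-sym : t ≋₃ t′ → t′ ≋₃ t
≋₃-sym t≋t′ u = ≋₃⇒⊇₃ t≋t′ u , ≋₃⇒⊆₃ t≋t′ u

≋₃-trans : t ≋₃ t′ → t′ ≋₃ t″ → t ≋₃ t″
≋₃-trans t≋t′ t′≋t″ u =
  ⊆₃-trans (≋₃⇒⊆₃ t≋t′) (≋₃⇒⊆₃ t′≋t″) u , ⊆₃-trans (≋₃⇒⊇₃ t′≋t″) (≋₃⇒⊇₃ t≋t′) u

⊆₃-intro : a ∈₃ t → b ∈₃ t → c ∈₃ t → (a , b , c) ⊆₃ t
⊆₃-intro a∈ b∈ c∈ _ first  = a∈
⊆₃-intro a∈ b∈ c∈ _ second = b∈
⊆₃-intro a∈ b∈ c∈ _ third  = c∈

Distinct₃ : A × A × A → Set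
Distinct₃ (a , b , c) = a ≢ b × b ≢ c × a ≢ c

data _↭₃_ {A : Set} : A × A × A → A × A × A → Set where
  abc : (a , b , c) ↭₃ (a , b , c)
  acb : (a , b , c) ↭₃ (a , c , b)
  bac : (a , b , c) ↭₃ (b , a , c)
  bca : (a , b , c) ↭₃ (b , c , a)
  cab : (a , b , c) ↭₃ (c , a , b)
  cba : (a , b , c) ↭₃ (c , b , a)

↭₃⇒≋₃ : t ↭₃ t′ → t ≋₃ t′
↭₃⇒≋₃ abc = ≋₃-refl
↭₃⇒≋₃ acb u = ⊆₃-intro first third second u , ⊆₃-intro first third second u
↭₃⇒≋₃ bac u = ⊆₃-intro second first third u , ⊆₃-intro second first third u
↭₃⇒≋₃ bca u = ⊆₃-intro third first second u , ⊆₃-intro second third first u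
↭₃⇒≋₃ cab u = ⊆₃-intro second third first u , ⊆₃-intro third first second u
↭₃⇒≋₃ cba u = ⊆₃-intro third second first u , ⊆₃-intro third second first u

Σ₃ : (A → ℕ) → A × A × A → ℕ
Σ₃ φ (a , b , c) = φ a + φ b + φ c

Σ₃-⊆₃ : (φ : A → ℕ) → Distinct₃ t → t ⊆₃ t′ → Σ₃ φ t ≡ Σ₃ φ t′
Σ₃-⊆₃ φ distinct t⊆t′ = by-position distinct (t⊆t′ _ first) (t⊆t′ _ second) (t⊆t′ _ third)
  where
  by-position : ∀ {p q r} → Distinct₃ (a , b , c) →
    a ∈₃ (p , q , r) → b ∈₃ (p , q , r) → c ∈₃ (p , q , r) → Σ₃ φ (a , b , c) ≡ Σ₃ φ (p , q , r)
  by-position (a≢b , _ , _) first  first  _      = contradiction refl a≢b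
  by-position (a≢b , _ , _) second second _      = contradiction refl a≢b
  by-position (a≢b , _ , _) third  third  _      = contradiction refl a≢b
  by-position (_ , _ , a≢c) first  _      first  = contradiction refl a≢c
  by-position (_ , _ , a≢c) second _      second = contradiction refl a≢c
  by-position (_ , _ , a≢c) third  _      third  = contradiction refl a≢c
  by-position (_ , b≢c , _) _      first  first  = contradiction refl b≢c
  by-position (_ , b≢c , _) _      second second = contradiction refl b≢c
  by-position (_ , b≢c , _) _      third  third  = contradiction refl b≢c
  by-position               _ first  second third  = refl
  by-position {p = p} {q} {r} _ first  third  second = xy∙z≈xz∙y (φ p) (φ r) (φ q)
  by-position {p = p} {q} {r} _ second first  third  = xy∙z≈yx∙z (φ q) (φ p) (φ r)
  by-position {p = p} {q} {r} _ second third  first  = xy∙z≈zx∙y (φ q) (φ r) (φ p)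
  by-position {p = p} {q} {r} _ third  first  second = xy∙z≈yz∙x (φ r) (φ p) (φ q)
  by-position {p = p} {q} {r} _ third  second first  = xy∙z≈zy∙x (φ r) (φ q) (φ p)

pair : A → A → Fin 2 → A
pair a b zero       = a
pair a b (suc zero) = b

pair-injective : a ≢ b → Injective _≡_ _≡_ (pair a b)
pair-injective a≢b {zero}     {zero}     _ = refl
pair-injective a≢b {zero}     {suc zero} e = contradiction e a≢b
pair-injective a≢b {suc zero} {zero}     e = contradiction (sym e) a≢b
pair-injective a≢b {suc zero} {suc zero} _ = refl

disjoint-injections⇒+≤ : ∀ {m₁ m₂} (g : Fin m₁ → Fin k) (h : Fin m₂ → Fin k) →
  Injective _≡_ _≡_ g → Injective _≡_ _≡_ h → (∀ i j → g i ≢ h j) → m₁ + m₂ ≤ k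
disjoint-injections⇒+≤ {m₁ = m₁} {m₂} g h g-injective h-injective disjoint =
  Fin.injective⇒≤ (splitAt-injective ∘ [g,h]-injective)
  where
  [g,h]-injective : Injective _≡_ _≡_ [ g , h ]
  [g,h]-injective {inj₁ i} {inj₁ j} e = cong inj₁ (g-injective e)
  [g,h]-injective {inj₁ i} {inj₂ j} e = contradiction e (disjoint i j)
  [g,h]-injective {inj₂ i} {inj₁ j} e = contradiction (sym e) (disjoint j i)
  [g,h]-injective {inj₂ i} {inj₂ j} e = cong inj₂ (h-injective e)

  splitAt-injective : Injective _≡_ _≡_ (splitAt m₁ {m₂})
  splitAt-injective {i} {j} e = begin
    i                         ≡⟨ Fin.join-splitAt m₁ m₂ i ⟨
    join m₁ m₂ (splitAt m₁ i) ≡⟨ cong (join m₁ m₂) e ⟩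
    join m₁ m₂ (splitAt m₁ j) ≡⟨ Fin.join-splitAt m₁ m₂ j ⟩
    j                         ∎
    where open ≡-Reasoning

-- Fixed points of involutions

module _ {m} (σ : Fin (suc m) → Fin (suc m)) (σ-involutive : Involutive _≡_ σ) where

  module Restrict {w : Fin (suc m)} (σw≡w : σ w ≡ w) where

    private
      w≢σ-punchIn : ∀ i → w ≢ σ (punchIn w i)
      w≢σ-punchIn i w≡σi = Fin.punchInᵢ≢i w i (begin
        punchIn w i         ≡⟨ σ-involutive (punchIn w i) ⟨
        σ (σ (punchIn w i)) ≡⟨ cong σ w≡σi ⟨
        σ w                 ≡⟨ σw≡w ⟩
        w                   ∎)
        where open ≡-Reasoning

    restrict : Fin m → Fin m
    restrict i = punchOut (w≢σ-punchIn i)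

    punchIn-restrict : ∀ i → punchIn w (restrict i) ≡ σ (punchIn w i)
    punchIn-restrict i = Fin.punchIn-punchOut (w≢σ-punchIn i)

    restrict-involutive : Involutive _≡_ restrict
    restrict-involutive i = Fin.punchIn-injective w _ _ (begin
      punchIn w (restrict (restrict i)) ≡⟨ punchIn-restrict (restrict i) ⟩
      σ (punchIn w (restrict i))        ≡⟨ cong σ (punchIn-restrict i) ⟩
      σ (σ (punchIn w i))               ≡⟨ σ-involutive (punchIn w i) ⟩
      punchIn w i                       ∎)
      where open ≡-Reasoning

    restrict-fixed⇒fixed : ∀ {i} → restrict i ≡ i → σ (punchIn w i) ≡ punchIn w i
    restrict-fixed⇒fixed {i} fixed = trans (sym (punchIn-restrict i)) (cong (punchIn w) fixed)

  -- Collapses the 2-cycle (0 , suc j) of σ to the fixed point j.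
  module Contract {j : Fin m} (σ0≡sj : σ zero ≡ suc j) where

    private
      dropZero : Fin m → Fin (suc m) → Fin m
      dropZero i zero    = i
      dropZero i (suc r) = r

    contract : Fin m → Fin m
    contract i = dropZero i (σ (suc i))

    private
      contract-stays : ∀ {i} → σ (suc i) ≡ zero → contract i ≡ i
      contract-stays = cong (dropZero _)

      contract-moves : ∀ {i r} → σ (suc i) ≡ suc r → contract i ≡ r
      contract-moves = cong (dropZero _)

    contract-involutive : Involutive _≡_ contract
    contract-involutive i with σ (suc i) in eq
    ... | zero  = contract-stays eq
    ... | suc r = contract-moves (trans (cong σ (sym eq)) (σ-involutive (suc i)))

    contract-fixes-j : contract j ≡ j
    contract-fixes-j = contract-stays (trans (cong σ (sym σ0≡sj)) (σ-involutive zero))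

    contract-fixed⇒fixed : ∀ {i} → i ≢ j → contract i ≡ i → σ (suc i) ≡ suc i
    contract-fixed⇒fixed {i} i≢j fixed with σ (suc i) in eq
    ... | zero  = contradiction (Fin.suc-injective (trans (sym (σ-involutive (suc i)))
                                                          (trans (cong σ eq) σ0≡sj))) i≢j
    ... | suc r = cong suc fixed

odd-involution-fixedPoint : ∀ h (σ : Fin (suc (h * 2)) → Fin (suc (h * 2))) →
  Involutive _≡_ σ → ∃[ i ] σ i ≡ i
even-involution-second-fixedPoint : ∀ h (σ : Fin (suc h * 2) → Fin (suc h * 2)) →
  Involutive _≡_ σ → ∀ {w} → σ w ≡ w → ∃[ w′ ] w′ ≢ w × σ w′ ≡ w′

odd-involution-fixedPoint zero σ _ with σ zero in eq
... | zero = zero , eq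
odd-involution-fixedPoint (suc h) σ σ-involutive with σ zero in eq
... | zero  = zero , eq
... | suc j =
  let open Contract σ σ-involutive eq
      (i , i≢j , fixed) =
        even-involution-second-fixedPoint h contract contract-involutive contract-fixes-j
  in suc i , contract-fixed⇒fixed i≢j fixed

even-involution-second-fixedPoint h σ σ-involutive {w} σw≡w =
  let open Restrict σ σ-involutive σw≡w
      (i , fixed) = odd-involution-fixedPoint h restrict restrict-involutive
  in punchIn w i , Fin.punchInᵢ≢i w i , restrict-fixed⇒fixed fixed

-- Congruence modulo suc m₀

module Congruence (m₀ : ℕ) where

  m : ℕ
  m = suc m₀

  infix 4 _≡ₘ_
  record _≡ₘ_ (a b : ℕ) : Set where
    constructor mod-≡
    field %-≡ : a % m ≡ b % m

  ≡ₘ-setoid : Setoid 0ℓ 0ℓ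
  ≡ₘ-setoid = record
    { _≈_           = _≡ₘ_
    ; isEquivalence = record
      { refl  = mod-≡ refl
      ; sym   = λ (mod-≡ a≡b) → mod-≡ (sym a≡b)
      ; trans = λ (mod-≡ a≡b) (mod-≡ b≡c) → mod-≡ (trans a≡b b≡c)
      }
    }

  open Setoid ≡ₘ-setoid public
    using () renaming (refl to ≡ₘ-refl; sym to ≡ₘ-sym; trans to ≡ₘ-trans; reflexive to ≡⇒≡ₘ)

  %-≡ₘ : ∀ a → a % m ≡ₘ a
  %-≡ₘ a = mod-≡ (m%n%n≡m%n a m)

  +-congₘ : ∀ {a a′ b b′} → a ≡ₘ a′ → b ≡ₘ b′ → a + b ≡ₘ a′ + b′
  +-congₘ {a} {a′} {b} {b′} (mod-≡ a≡a′) (mod-≡ b≡b′) = mod-≡ (begin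
    (a + b) % m             ≡⟨ %-distribˡ-+ a b m ⟩
    (a % m + b % m) % m     ≡⟨ cong₂ (λ p q → (p + q) % m) a≡a′ b≡b′ ⟩
    (a′ % m + b′ % m) % m   ≡⟨ %-distribˡ-+ a′ b′ m ⟨
    (a′ + b′) % m           ∎)
    where open ≡-Reasoning

  *-congˡₘ : ∀ c {a a′} → a ≡ₘ a′ → c * a ≡ₘ c * a′
  *-congˡₘ c {a} {a′} (mod-≡ a≡a′) = mod-≡ (begin
    (c * a) % m             ≡⟨ %-distribˡ-* c a m ⟩
    (c % m * (a % m)) % m   ≡⟨ cong (λ p → (c % m * p) % m) a≡a′ ⟩
    (c % m * (a′ % m)) % m  ≡⟨ %-distribˡ-* c a′ m ⟨
    (c * a′) % m            ∎)
    where open ≡-Reasoning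

  +m-≡ₘ : ∀ a → a + m ≡ₘ a
  +m-≡ₘ a = mod-≡ ([m+n]%n≡m%n a m)

  suc-cancelₘ : ∀ {a b} → suc a ≡ₘ suc b → a ≡ₘ b
  suc-cancelₘ {a} {b} sa≡sb = begin
    a           ≈⟨ +m-≡ₘ a ⟨
    a + m       ≡⟨ ℕ.+-suc a m₀ ⟩
    suc a + m₀  ≈⟨ +-congₘ sa≡sb ≡ₘ-refl ⟩
    suc b + m₀  ≡⟨ ℕ.+-suc b m₀ ⟨
    b + m       ≈⟨ +m-≡ₘ b ⟩
    b           ∎
    where open ≈-Reasoning ≡ₘ-setoid

  +-cancelˡₘ : ∀ c {a b} → c + a ≡ₘ c + b → a ≡ₘ b
  +-cancelˡₘ zero    a≡b = a≡b
  +-cancelˡₘ (suc c) a≡b = +-cancelˡₘ c (suc-cancelₘ a≡b)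

  ≡ₘ⇒≡ : ∀ {a b} → a < m → b < m → a ≡ₘ b → a ≡ b
  ≡ₘ⇒≡ a<m b<m (mod-≡ a≡b) = trans (sym (m<n⇒m%n≡m a<m)) (trans a≡b (m<n⇒m%n≡m b<m))

module _ (h : ℕ) where

  open Congruence (h * 2)

  -- suc h inverts 2 modulo m = suc (h * 2).
  2*-cancelₘ : ∀ {a b} → 2 * a ≡ₘ 2 * b → a ≡ₘ b
  2*-cancelₘ {a} {b} 2a≡2b = begin
    a                  ≈⟨ halve a ⟨
    suc h * (2 * a)    ≈⟨ *-congˡₘ (suc h) 2a≡2b ⟩
    suc h * (2 * b)    ≈⟨ halve b ⟩
    b                  ∎
    where
    open ≈-Reasoning ≡ₘ-setoid

    [1+h]*2a≡a+a*m : ∀ h a → suc h * (2 * a) ≡ a + a * suc (h * 2)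
    [1+h]*2a≡a+a*m = solve-∀

    halve : ∀ a → suc h * (2 * a) ≡ₘ a
    halve a = ≡ₘ-trans (≡⇒≡ₘ ([1+h]*2a≡a+a*m h a)) (mod-≡ ([m+kn]%n≡m%n a a m))

-- SamePalette f T₁ T₂ unfolds to edgeColours f (vertices T₁) ≋₃ edgeColours f (vertices T₂).
edgeColours : EdgeColouring n k → Fin n × Fin n × Fin n → Fin k × Fin k × Fin k
edgeColours f (a , b , c) = col f a b , col f b c , col f a c

module _ (f : EdgeColouring n k) where

  pair-colour-∈ : u ∈₃ t → w ∈₃ t → u ≢ w → col f u w ∈₃ edgeColours f t
  pair-colour-∈ first  first  u≢w = contradiction refl u≢w
  pair-colour-∈ first  second _   = first
  pair-colour-∈ first  third  _   = third
  pair-colour-∈ second first  _   = inj₁ (symm f _ _)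
  pair-colour-∈ second second u≢w = contradiction refl u≢w
  pair-colour-∈ second third  _   = second
  pair-colour-∈ third  first  _   = inj₂ (inj₂ (symm f _ _))
  pair-colour-∈ third  second _   = inj₂ (inj₁ (symm f _ _))
  pair-colour-∈ third  third  u≢w = contradiction refl u≢w

  edgeColours-⊆₃ : Distinct₃ t → t ⊆₃ t′ → edgeColours f t ⊆₃ edgeColours f t′
  edgeColours-⊆₃ (a≢b , b≢c , a≢c) t⊆t′ _ first  = pair-colour-∈ (t⊆t′ _ first) (t⊆t′ _ second) a≢b
  edgeColours-⊆₃ (a≢b , b≢c , a≢c) t⊆t′ _ second = pair-colour-∈ (t⊆t′ _ second) (t⊆t′ _ third) b≢c
  edgeColours-⊆₃ (a≢b , b≢c , a≢c) t⊆t′ _ third  = pair-colour-∈ (t⊆t′ _ first) (t⊆t′ _ third) a≢c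

  edgeColours-≋₃ : Distinct₃ t → Distinct₃ t′ → t ≋₃ t′ → edgeColours f t ≋₃ edgeColours f t′
  edgeColours-≋₃ dt dt′ t≋t′ u =
    edgeColours-⊆₃ dt (≋₃⇒⊆₃ t≋t′) u , edgeColours-⊆₃ dt′ (≋₃⇒⊇₃ t≋t′) u

  edgeColours-distinct : Proper f → Distinct₃ t → Distinct₃ (edgeColours f t)
  edgeColours-distinct {t = a , b , c} proper (a≢b , b≢c , a≢c) =
      (λ ab≡bc → proper b a c a≢b (≢-sym b≢c) a≢c (trans (symm f b a) ab≡bc))
    , (λ bc≡ac → proper c b a b≢c a≢c (≢-sym a≢b) (trans (symm f c b) (trans bc≡ac (symm f a c))))
    , proper a b c (≢-sym a≢b) (≢-sym a≢c) b≢c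

vertices : Triangle n → Fin n × Fin n × Fin n
vertices T = x T , y T , z T

SameTriangle : Triangle n → Triangle n → Set
SameTriangle T₁ T₂ = (x T₁ ≡ x T₂) × (y T₁ ≡ y T₂) × (z T₁ ≡ z T₂)

vertices-distinct : (T : Triangle n) → Distinct₃ (vertices T)
vertices-distinct T = Fin.<⇒≢ (x<y T) , Fin.<⇒≢ (y<z T) , Fin.<⇒≢ (Fin.<-trans (x<y T) (y<z T))

triangleOn : Distinct₃ (a , b , c) → Σ[ T ∈ Triangle n ] vertices T ≋₃ (a , b , c)
triangleOn {a = a} {b} {c} (a≢b , b≢c , a≢c) with Fin.<-cmp a b | Fin.<-cmp b c | Fin.<-cmp a c
... | tri≈ _ a≡b _ | _ | _ = contradiction a≡b a≢b
... | _ | tri≈ _ b≡c _ | _ = contradiction b≡c b≢c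
... | _ | _ | tri≈ _ a≡c _ = contradiction a≡c a≢c
... | tri< a<b _ _ | tri< b<c _ _ | _            = tri a b c a<b b<c , ↭₃⇒≋₃ abc
... | tri< a<b _ _ | tri> _ _ c<b | tri< a<c _ _ = tri a c b a<c c<b , ↭₃⇒≋₃ acb
... | tri< a<b _ _ | tri> _ _ c<b | tri> _ _ c<a = tri c a b c<a a<b , ↭₃⇒≋₃ bca
... | tri> _ _ b<a | tri< b<c _ _ | tri< a<c _ _ = tri b a c b<a a<c , ↭₃⇒≋₃ bac
... | tri> _ _ b<a | tri< b<c _ _ | tri> _ _ c<a = tri b c a b<c c<a , ↭₃⇒≋₃ cab
... | tri> _ _ b<a | tri> _ _ c<b | _            = tri c b a c<b b<a , ↭₃⇒≋₃ cba

SameTriangle⇒≋₃ : (T₁ T₂ : Triangle n) → SameTriangle T₁ T₂ → vertices T₁ ≋₃ vertices T₂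
SameTriangle⇒≋₃ (tri _ _ _ _ _) (tri _ _ _ _ _) (refl , refl , refl) = ≋₃-refl

≋₃⇒SameTriangle : (T₁ T₂ : Triangle n) → vertices T₁ ≋₃ vertices T₂ → SameTriangle T₁ T₂
≋₃⇒SameTriangle T₁ T₂ T₁≋T₂ = x₁≡x₂ , y₁≡y₂ , z₁≡z₂
  where
  x-≤ : ∀ T → u ∈₃ vertices T → x T Fin.≤ u
  x-≤ T first  = Fin.≤-refl
  x-≤ T second = ℕ.<⇒≤ (x<y T)
  x-≤ T third  = ℕ.<⇒≤ (Fin.<-trans (x<y T) (y<z T))

  ≤-z : ∀ T → u ∈₃ vertices T → u Fin.≤ z T
  ≤-z T first  = ℕ.<⇒≤ (Fin.<-trans (x<y T) (y<z T))
  ≤-z T second = ℕ.<⇒≤ (y<z T)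
  ≤-z T third  = Fin.≤-refl

  x₁≡x₂ : x T₁ ≡ x T₂
  x₁≡x₂ = Fin.≤-antisym (x-≤ T₁ (≋₃⇒⊇₃ T₁≋T₂ _ first)) (x-≤ T₂ (≋₃⇒⊆₃ T₁≋T₂ _ first))

  z₁≡z₂ : z T₁ ≡ z T₂
  z₁≡z₂ = Fin.≤-antisym (≤-z T₂ (≋₃⇒⊆₃ T₁≋T₂ _ third)) (≤-z T₁ (≋₃⇒⊇₃ T₁≋T₂ _ third))

  y₁≡y₂ : y T₁ ≡ y T₂
  y₁≡y₂ with ≋₃⇒⊆₃ T₁≋T₂ _ second
  ... | inj₁ y₁≡x₂        = contradiction (trans x₁≡x₂ (sym y₁≡x₂)) (Fin.<⇒≢ (x<y T₁))
  ... | inj₂ (inj₁ y₁≡y₂) = y₁≡y₂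
  ... | inj₂ (inj₂ y₁≡z₂) = contradiction (trans y₁≡z₂ (sym z₁≡z₂)) (Fin.<⇒≢ (y<z T₁))

-- The colouring i + j mod m

module SumColouring (h : ℕ) {n : ℕ} (n≤m : n ≤ suc (h * 2)) where

  open Congruence (h * 2)

  colour : Fin n → Fin n → Fin m
  colour i j = (toℕ i + toℕ j) mod m

  sumColouring : EdgeColouring n m
  sumColouring = record { col = colour ; symm = λ i j → cong (_mod m) (ℕ.+-comm (toℕ i) (toℕ j)) }

  private
    toℕ-colour : ∀ i j → toℕ (colour i j) ≡ₘ toℕ i + toℕ j
    toℕ-colour i j = ≡ₘ-trans (≡⇒≡ₘ (Fin.toℕ-fromℕ< _)) (%-≡ₘ _)

    toℕ<m : ∀ (i : Fin n) → toℕ i < m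
    toℕ<m i = ℕ.<-≤-trans (Fin.toℕ<n i) n≤m

    ≡ₘ⇒≡-vertex : ∀ {i j : Fin n} → toℕ i ≡ₘ toℕ j → i ≡ j
    ≡ₘ⇒≡-vertex {i} {j} = Fin.toℕ-injective ∘ ≡ₘ⇒≡ (toℕ<m i) (toℕ<m j)

  proper : Proper sumColouring
  proper v a b _ _ a≢b va≡vb = a≢b (≡ₘ⇒≡-vertex (+-cancelˡₘ (toℕ v) (begin
    toℕ v + toℕ a       ≈⟨ toℕ-colour v a ⟨
    toℕ (colour v a)    ≡⟨ cong toℕ va≡vb ⟩
    toℕ (colour v b)    ≈⟨ toℕ-colour v b ⟩
    toℕ v + toℕ b       ∎)))
    where open ≈-Reasoning ≡ₘ-setoid

  private
    Σ : Fin n × Fin n × Fin n → ℕ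
    Σ = Σ₃ toℕ

    palette-sum : ∀ t → Σ₃ toℕ (edgeColours sumColouring t) ≡ₘ 2 * Σ t
    palette-sum (a , b , c) = ≡ₘ-trans
      (+-congₘ (+-congₘ (toℕ-colour a b) (toℕ-colour b c)) (toℕ-colour a c))
      (≡⇒≡ₘ (double-sum (toℕ a) (toℕ b) (toℕ c)))
      where
      double-sum : ∀ a b c → a + b + (b + c) + (a + c) ≡ 2 * (a + b + c)
      double-sum = solve-∀

    opposite : ∀ (v w u : Fin n) → toℕ (colour v w) + toℕ u ≡ₘ toℕ v + toℕ w + toℕ u
    opposite v w u = +-congₘ (toℕ-colour v w) ≡ₘ-refl

    opposite-a : ∀ (a b c : Fin n) → toℕ (colour b c) + toℕ a ≡ₘ Σ (a , b , c)
    opposite-a a b c = ≡ₘ-trans (opposite b c a) (≡⇒≡ₘ (xy∙z≈zx∙y (toℕ b) (toℕ c) (toℕ a)))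

    opposite-b : ∀ (a b c : Fin n) → toℕ (colour a c) + toℕ b ≡ₘ Σ (a , b , c)
    opposite-b a b c = ≡ₘ-trans (opposite a c b) (≡⇒≡ₘ (xy∙z≈xz∙y (toℕ a) (toℕ c) (toℕ b)))

    opposite-c : ∀ (a b c : Fin n) → toℕ (colour a b) + toℕ c ≡ₘ Σ (a , b , c)
    opposite-c a b c = opposite a b c

    vertex-opposite : ∀ {u} t → u ∈₃ t →
      ∃[ γ ] γ ∈₃ edgeColours sumColouring t × toℕ γ + toℕ u ≡ₘ Σ t
    vertex-opposite (a , b , c) first  = colour b c , second , opposite-a a b c
    vertex-opposite (a , b , c) second = colour a c , third  , opposite-b a b c
    vertex-opposite (a , b , c) third  = colour a b , first  , opposite-c a b c

    colour-opposite : ∀ {γ} t → γ ∈₃ edgeColours sumColouring t →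
      ∃[ u ] u ∈₃ t × toℕ γ + toℕ u ≡ₘ Σ t
    colour-opposite (a , b , c) first  = c , third  , opposite-c a b c
    colour-opposite (a , b , c) second = a , first  , opposite-a a b c
    colour-opposite (a , b , c) third  = b , second , opposite-b a b c

    vertices-⊆₃ : ∀ t t′ → Σ t ≡ₘ Σ t′ →
      edgeColours sumColouring t ⊆₃ edgeColours sumColouring t′ → t ⊆₃ t′
    vertices-⊆₃ t t′ Σt≡Σt′ colours⊆ u u∈t =
      let (γ , γ∈t , γu≡Σt) = vertex-opposite t u∈t
          (u′ , u′∈t′ , γu′≡Σt′) = colour-opposite t′ (colours⊆ γ γ∈t)
          u≡u′ = ≡ₘ⇒≡-vertex (+-cancelˡₘ (toℕ γ)
                   (≡ₘ-trans γu≡Σt (≡ₘ-trans Σt≡Σt′ (≡ₘ-sym γu′≡Σt′))))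
      in subst (_∈₃ t′) (sym u≡u′) u′∈t′

  distinguishes : DistinguishesTriangles sumColouring
  distinguishes T₁ T₂ different samePalette = different (≋₃⇒SameTriangle T₁ T₂ λ u →
      vertices-⊆₃ t₁ t₂ Σt₁≡Σt₂ (≋₃⇒⊆₃ samePalette) u
    , vertices-⊆₃ t₂ t₁ (≡ₘ-sym Σt₁≡Σt₂) (≋₃⇒⊇₃ samePalette) u)
    where
    t₁ t₂ : Fin n × Fin n × Fin n
    t₁ = vertices T₁
    t₂ = vertices T₂

    Σt₁≡Σt₂ : Σ t₁ ≡ₘ Σ t₂
    Σt₁≡Σt₂ = 2*-cancelₘ h (begin
      2 * Σ t₁                              ≈⟨ palette-sum t₁ ⟨
      Σ₃ toℕ (edgeColours sumColouring t₁)  ≡⟨ Σ₃-⊆₃ toℕ distinct (≋₃⇒⊆₃ samePalette) ⟩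
      Σ₃ toℕ (edgeColours sumColouring t₂)  ≈⟨ palette-sum t₂ ⟩
      2 * Σ t₂                              ∎)
      where
      open ≈-Reasoning ≡ₘ-setoid
      distinct : Distinct₃ (edgeColours sumColouring t₁)
      distinct = edgeColours-distinct sumColouring proper (vertices-distinct T₁)

  tdColourable : TDColourable n m
  tdColourable = sumColouring , proper , distinguishes

-- Lower bounds

Sees : EdgeColouring n k → Fin n → Fin k → Set
Sees f v γ = ∃[ w ] w ≢ v × col f v w ≡ γ

sees? : (f : EdgeColouring n k) (v : Fin n) (γ : Fin k) → Dec (Sees f v γ)
sees? f v γ = Fin.any? λ w → ¬? (w Fin.≟ v) ×-dec (col f v w Fin.≟ γ)

neighbour-unique : (f : EdgeColouring n k) → Proper f →
  w₁ ≢ v → w₂ ≢ v → col f v w₁ ≡ col f v w₂ → w₁ ≡ w₂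
neighbour-unique {w₁ = w₁} {w₂ = w₂} f proper w₁≢v w₂≢v e =
  decidable-stable (w₁ Fin.≟ w₂) λ w₁≢w₂ → proper _ _ _ w₁≢v w₂≢v w₁≢w₂ e

module _ (f : EdgeColouring (suc n) k) (proper : Proper f) (v : Fin (suc n)) where

  incident : Fin n → Fin k
  incident i = col f v (punchIn v i)

  incident-injective : Injective _≡_ _≡_ incident
  incident-injective {i} {j} e =
    Fin.punchIn-injective v i j
      (neighbour-unique f proper (Fin.punchInᵢ≢i v i) (Fin.punchInᵢ≢i v j) e)

  degree≤colours : n ≤ k
  degree≤colours = Fin.injective⇒≤ incident-injective

  missing+degree≤colours : ∀ {s} (missing : Fin s → Fin k) → Injective _≡_ _≡_ missing →
    (∀ j → ¬ Sees f v (missing j)) → s + n ≤ k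
  missing+degree≤colours missing missing-injective misses =
    disjoint-injections⇒+≤ missing incident missing-injective incident-injective
      λ j i e → misses j (punchIn v i , Fin.punchInᵢ≢i v i , sym e)

module _ (f : EdgeColouring n k) (proper : Proper f) (α : Fin k) where

  partner : Fin n → Fin n
  partner v with sees? f v α
  ... | yes (w , _) = w
  ... | no _        = v

  partner-sees : w ≢ v → col f v w ≡ α → partner v ≡ w
  partner-sees {w = w} {v = v} w≢v vw≡α with sees? f v α
  ... | yes (w′ , w′≢v , vw′≡α) = neighbour-unique f proper w′≢v w≢v (trans vw′≡α (sym vw≡α))
  ... | no misses               = contradiction (w , w≢v , vw≡α) misses

  partner-misses : ¬ Sees f v α → partner v ≡ v
  partner-misses {v = v} misses with sees? f v α
  ... | yes sees = contradiction sees misses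
  ... | no _     = refl

  partner-involutive : Involutive _≡_ partner
  partner-involutive v with sees? f v α
  ... | yes (w , w≢v , vw≡α) = partner-sees (≢-sym w≢v) (trans (symm f w v) vw≡α)
  ... | no misses            = partner-misses misses

  partner-fixed⇒misses : partner v ≡ v → ¬ Sees f v α
  partner-fixed⇒misses fixed (w , w≢v , vw≡α) = w≢v (trans (sym (partner-sees w≢v vw≡α)) fixed)

hub-unique : (f : EdgeColouring n k) → Distinct₃ (edgeColours f (v , a , b)) →
  u ∈₃ (v , a , b) → w₁ ∈₃ (v , a , b) → w₂ ∈₃ (v , a , b) → u ≢ w₁ → u ≢ w₂ →
  col f u w₁ ≡ col f v a → col f u w₂ ≡ col f v b → u ≡ v
hub-unique f _ first _ _ _ _ _ _ = refl
hub-unique f (_ , _ , va≢vb) second _ first _ _ _ e₂ =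
  contradiction (trans (symm f _ _) e₂) va≢vb
hub-unique f _ second _ second _ u≢w₂ _ _ = contradiction refl u≢w₂
hub-unique f (_ , ab≢vb , _) second _ third _ _ _ e₂ = contradiction e₂ ab≢vb
hub-unique f (_ , _ , va≢vb) third first _ _ _ e₁ _ =
  contradiction (trans (symm f _ _) e₁) (va≢vb ∘ sym)
hub-unique f (va≢ab , _ , _) third second _ _ _ e₁ _ =
  contradiction (trans (symm f _ _) e₁) (va≢ab ∘ sym)
hub-unique f _ third third _ u≢w₁ _ _ _ = contradiction refl u≢w₁

module _ (f : EdgeColouring n k) (proper : Proper f) (distinguishes : DistinguishesTriangles f)
         {α β : Fin k} (α≢β : α ≢ β) (seesα : ∀ v → Sees f v α) (seesβ : ∀ v → Sees f v β) where

  private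
    p q : Fin n → Fin n
    p v = proj₁ (seesα v)
    q v = proj₁ (seesβ v)

    vp≡α : ∀ v → col f v (p v) ≡ α
    vp≡α v = proj₂ (proj₂ (seesα v))

    vq≡β : ∀ v → col f v (q v) ≡ β
    vq≡β v = proj₂ (proj₂ (seesβ v))

    spokes-distinct : ∀ v → Distinct₃ (v , p v , q v)
    spokes-distinct v =
        ≢-sym (proj₁ (proj₂ (seesα v)))
      , (λ p≡q → α≢β (trans (sym (vp≡α v)) (trans (cong (col f v) p≡q) (vq≡β v))))
      , ≢-sym (proj₁ (proj₂ (seesβ v)))

    spoke-colours-distinct : ∀ v → Distinct₃ (edgeColours f (v , p v , q v))
    spoke-colours-distinct v = edgeColours-distinct f proper (spokes-distinct v)

    d : Fin n → Fin k
    d v = col f (p v) (q v)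

    d≢α : ∀ v → d v ≢ α
    d≢α v e = proj₁ (spoke-colours-distinct v) (trans (vp≡α v) (sym e))

    d≢β : ∀ v → d v ≢ β
    d≢β v e = proj₁ (proj₂ (spoke-colours-distinct v)) (trans e (sym (vq≡β v)))

    T : Fin n → Triangle n
    T v = proj₁ (triangleOn (spokes-distinct v))

    palette-T : ∀ v → edgeColours f (vertices (T v)) ≋₃ (α , d v , β)
    palette-T v = ≋₃-trans
      (edgeColours-≋₃ f (vertices-distinct (T v)) (spokes-distinct v)
                        (proj₂ (triangleOn (spokes-distinct v))))
      (subst₂ (λ γ δ → (col f v (p v) , d v , col f v (q v)) ≋₃ (γ , d v , δ))
              (vp≡α v) (vq≡β v) ≋₃-refl)

    hub-determined : ∀ v v′ → SameTriangle (T v) (T v′) → v′ ≡ v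
    hub-determined v v′ same =
      hub-unique f (spoke-colours-distinct v) (members _ first) (members _ second) (members _ third)
        (proj₁ (spokes-distinct v′)) (proj₂ (proj₂ (spokes-distinct v′)))
        (trans (vp≡α v′) (sym (vp≡α v))) (trans (vq≡β v′) (sym (vq≡β v)))
      where
      members : (v′ , p v′ , q v′) ⊆₃ (v , p v , q v)
      members = ⊆₃-trans (≋₃⇒⊇₃ (proj₂ (triangleOn (spokes-distinct v′))))
                (⊆₃-trans (≋₃⇒⊇₃ (SameTriangle⇒≋₃ (T v) (T v′) same))
                          (≋₃⇒⊆₃ (proj₂ (triangleOn (spokes-distinct v)))))

    d-injective : Injective _≡_ _≡_ d
    d-injective {v} {v′} dv≡dv′ = decidable-stable (v Fin.≟ v′) λ v≢v′ →
      distinguishes (T v) (T v′) (v≢v′ ∘ sym ∘ hub-determined v v′)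
        (≋₃-trans (palette-T v) (subst (λ δ → (α , δ , β) ≋₃ edgeColours f (vertices (T v′)))
                                       (sym dv≡dv′) (≋₃-sym (palette-T v′))))

  two-colours-seen-everywhere⇒2+n≤k : 2 + n ≤ k
  two-colours-seen-everywhere⇒2+n≤k =
    disjoint-injections⇒+≤ (pair α β) d (pair-injective α≢β) d-injective avoids
    where
    avoids : ∀ j v → pair α β j ≢ d v
    avoids zero       v = ≢-sym (d≢α v)
    avoids (suc zero) v = ≢-sym (d≢β v)

tdColourable⇒n≤k : 3 ≤ n → TDColourable n k → n ≤ k
tdColourable⇒n≤k {suc zero}       (s≤s ()) _
tdColourable⇒n≤k {suc (suc zero)} (s≤s (s≤s ())) _
tdColourable⇒n≤k {suc (suc (suc n))} {k} _ (f , proper , distinguishes)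
  with ℕ.m≤n⇒m<n∨m≡n (degree≤colours f proper zero)
... | inj₁ n<k  = n<k
... | inj₂ refl = contradiction (ℕ.m+n≤o⇒n≤o 2 2+n≤k) (ℕ.n≮n _)
  where
  sees-all : ∀ γ v → Sees f v γ
  sees-all γ v = decidable-stable (sees? f v γ) λ misses →
    ℕ.n≮n _ (missing+degree≤colours f proper v (λ (_ : Fin 1) → γ) (λ { {zero} {zero} _ → refl })
                                    (λ _ → misses))

  2+n≤k : 2 + suc (suc (suc n)) ≤ suc (suc n)
  2+n≤k = two-colours-seen-everywhere⇒2+n≤k f proper distinguishes (λ ())
            (sees-all zero) (sees-all (suc zero))

module _ (h : ℕ) (f : EdgeColouring (suc (suc h) * 2) (suc (suc h) * 2))
         (proper : Proper f) (distinguishes : DistinguishesTriangles f) where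

  private
    N′ N : ℕ
    N′ = suc (suc (suc (h * 2)))
    N = suc N′

    misses-unique : ∀ {v α β} → ¬ Sees f v α → ¬ Sees f v β → α ≡ β
    misses-unique {v} {α} {β} missesα missesβ = decidable-stable (α Fin.≟ β) λ α≢β →
      ℕ.n≮n _ (missing+degree≤colours f proper v (pair α β) (pair-injective α≢β) λ where
        zero       → missesα
        (suc zero) → missesβ)

    seen-everywhere-unique : ∀ {α β} → (∀ v → Sees f v α) → (∀ v → Sees f v β) → α ≡ β
    seen-everywhere-unique {α} {β} seesα seesβ = decidable-stable (α Fin.≟ β) λ α≢β →
      contradiction
        (ℕ.m+n≤o⇒n≤o 1 (two-colours-seen-everywhere⇒2+n≤k f proper distinguishes α≢β seesα seesβ))
        (ℕ.n≮n _)

    missed-twice : ∀ {w α} → ¬ Sees f w α → ∃[ w′ ] w′ ≢ w × ¬ Sees f w′ α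
    missed-twice {w} {α} misses =
      let (w′ , w′≢w , fixed) = even-involution-second-fixedPoint (suc h) (partner f proper α)
                                  (partner-involutive f proper α) (partner-misses f proper α misses)
      in w′ , w′≢w , partner-fixed⇒misses f proper α fixed

    all-but-one-missed : Σ[ α ∈ Fin N ] (∀ γ → γ ≢ α → ∃[ v ] ¬ Sees f v γ)
    all-but-one-missed with Fin.any? (λ γ → Fin.all? (λ v → sees? f v γ))
    ... | yes (α , seesα) = α , λ γ γ≢α → Fin.¬∀⟶∃¬ N _ (λ v → sees? f v γ)
                                            (γ≢α ∘ λ seesγ → seen-everywhere-unique seesγ seesα)
    ... | no none-seen = zero , λ γ _ → Fin.¬∀⟶∃¬ N _ (λ v → sees? f v γ) (none-seen ∘ (γ ,_))

    α : Fin N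
    α = proj₁ all-but-one-missed

    misser : Fin N′ → Fin N
    misser c = proj₁ (proj₂ all-but-one-missed (punchIn α c) (Fin.punchInᵢ≢i α c))

    misser-misses : ∀ c → ¬ Sees f (misser c) (punchIn α c)
    misser-misses c = proj₂ (proj₂ all-but-one-missed (punchIn α c) (Fin.punchInᵢ≢i α c))

    co-misser : Fin N′ → Fin N
    co-misser c = proj₁ (missed-twice (misser-misses c))

    co-misser≢misser : ∀ c → co-misser c ≢ misser c
    co-misser≢misser c = proj₁ (proj₂ (missed-twice (misser-misses c)))

    co-misser-misses : ∀ c → ¬ Sees f (co-misser c) (punchIn α c)
    co-misser-misses c = proj₂ (proj₂ (missed-twice (misser-misses c)))

    missed-index-unique : ∀ {v w c c′} → v ≡ w →
      ¬ Sees f v (punchIn α c) → ¬ Sees f w (punchIn α c′) → c ≡ c′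
    missed-index-unique refl misses misses′ =
      Fin.punchIn-injective α _ _ (misses-unique misses misses′)

  N′+N′≤N : N′ + N′ ≤ N
  N′+N′≤N = disjoint-injections⇒+≤ misser co-misser
    (λ e → missed-index-unique e (misser-misses _) (misser-misses _))
    (λ e → missed-index-unique e (co-misser-misses _) (co-misser-misses _))
    λ c c′ e → co-misser≢misser c′
      (subst (λ c → co-misser c′ ≡ misser c)
             (missed-index-unique e (misser-misses c) (co-misser-misses c′)) (sym e))

even⇒¬TDColourable-n : ∀ h → ¬ TDColourable (suc (suc h) * 2) (suc (suc h) * 2)
even⇒¬TDColourable-n h (f , proper , distinguishes) =
  contradiction (ℕ.+-cancelʳ-≤ (3 + h * 2) (3 + h * 2) 1 (N′+N′≤N h f proper distinguishes))
                λ { (s≤s ()) }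

isTauPrime-odd : ∀ h → 3 ≤ suc (h * 2) → IsTauPrime (suc (h * 2)) (suc (h * 2))
isTauPrime-odd h 3≤n = SumColouring.tdColourable h ℕ.≤-refl , λ k → tdColourable⇒n≤k 3≤n

isTauPrime-even : ∀ h → 3 ≤ h * 2 → IsTauPrime (h * 2) (h * 2 + 1)
isTauPrime-even (suc zero) (s≤s (s≤s ()))
isTauPrime-even (suc (suc h)) 3≤N =
    subst (TDColourable N) (ℕ.+-comm 1 N) (SumColouring.tdColourable (suc (suc h)) (ℕ.n≤1+n N))
  , λ k colourable → subst (_≤ k) (ℕ.+-comm 1 N)
      (ℕ.≤∧≢⇒< (tdColourable⇒n≤k 3≤N colourable) λ { refl → even⇒¬TDColourable-n h colourable })
  where
  N : ℕ
  N = suc (suc h) * 2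

even-or-odd : ∀ n → (∃[ h ] n ≡ h * 2) ⊎ (∃[ h ] n ≡ suc (h * 2))
even-or-odd zero = inj₁ (0 , refl)
even-or-odd (suc n) with even-or-odd n
... | inj₁ (h , refl) = inj₂ (h , refl)
... | inj₂ (h , refl) = inj₁ (suc h , refl)

odd⇒¬2∣ : ∀ h → ¬ 2 ∣ suc (h * 2)
odd⇒¬2∣ h (divides q n≡q*2) =
  ℕ.even≢odd q h (trans (ℕ.*-comm 2 q) (trans (sym n≡q*2) (cong suc (ℕ.*-comm h 2))))

mainTheorem1 : ∀ (n : ℕ) → 3 ≤ n →
    (¬ (2 ∣ n) → IsTauPrime n n) × (2 ∣ n → IsTauPrime n (n + 1))
mainTheorem1 n 3≤n with even-or-odd n
... | inj₁ (h , refl) = (λ 2∤n → contradiction (n∣m*n h) 2∤n) , λ _ → isTauPrime-even h 3≤n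
... | inj₂ (h , refl) = (λ _ → isTauPrime-odd h 3≤n) , λ 2∣n → contradiction 2∣n (odd⇒¬2∣ h)
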